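{- Let $f\colon\mathbb{F}_2^k\to\mathbb{F}_2$ be a Boolean function of diameter $k$, and suppose that for some $j\in\{1,\dotsc,k\}$ the function $f(x_1,\dotsc,x_k)\oplus x_j$ does not depend on $x_j$. Suppose further that for each integer $t$ with $1-j\leq t\leq k-j$ such that $f(x_1,\dotsc,x_k)\oplus x_j$ depends on $x_{j+t}$, we have the identity \[ \bigl(f(x_1,\dotsc,x_k)\oplus x_j\bigr)\bigl(f(x_{1+t},\dotsc,x_{k+t})\oplus x_{j+t}\bigr)=0 \] for all values of the (integer-indexed) variables involved. Then $f$ is a $(k,n)$-lifting for each $n\geq k$.
   Context: A Boolean function $f\colon\mathbb{F}_2^k\to\mathbb{F}_2$ induces, for every $n\geq k$, the shift-invariant map $F\colon\mathbb{F}_2^n\to\mathbb{F}_2^n$ given by $F(x)_i=f(x_i,x_{i+1},\dotsc,x_{i+k-1})$ for $i=1,\dotsc,n$, with indices taken modulo $n$. The function $f$ has diameter $k$ if it depends on both $x_1$ and $x_k$. For $n\geq k$, $f$ is a $(k,n)$-lifting if $f$ has diameter $k$ and the induced $F\colon\mathbb{F}_2^n\to\mathbb{F}_2^n$ is bijective. -}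

module Defs where

open import Data.Bool using (Bool; true; false; not; _xor_; _∧_)
open import Data.Nat using (ℕ; zero; suc; _+_; _≤_)
open import Data.Nat.DivMod using (_mod_)
open import Data.Fin using (Fin; toℕ; fromℕ)
open import Data.Vec using (Vec; lookup; tabulate; _[_]%=_)
open import Data.Integer using (ℤ; +_; _-_) renaming (_+_ to _+ℤ_)
open import Data.Product using (∃)
open import Data.Empty using (⊥)
open import Relation.Binary.PropositionalEquality using (_≡_; _≢_)
open import Function using (id)
open import Function.Definitions using (Bijective)

-- Boolean functions of k variables; variables are indexed 0 .. k-1
-- (paper's x_1 .. x_k correspond to Fin indices 0 .. k-1).
BoolFun : ℕ → Set
BoolFun k = Vec Bool k → Bool

DependsOn : ∀ {k} → BoolFun k → Fin k → Set
DependsOn f i = ∃ λ x → f x ≢ f (x [ i ]%= not)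

HasDiameter : ∀ {m} → BoolFun (suc m) → Set
HasDiameter {m} f = DependsOn f Data.Fin.zero × DependsOn f (fromℕ m)
  where open import Data.Product using (_×_)

-- the induced shift-invariant map F : F_2^n → F_2^n,
-- F(x)_i = f(x_i, x_{i+1}, …, x_{i+k-1}), indices mod n.
-- (n = 0 is never used: liftings require n ≥ k ≥ 1.)
induced : ∀ {k} → BoolFun k → (n : ℕ) → Vec Bool n → Vec Bool n
induced f zero = id
induced {k} f (suc n) x =
  tabulate λ i → f (tabulate λ (a : Fin k) → lookup x ((toℕ i + toℕ a) mod (suc n)))

IsLifting : ∀ {m} → BoolFun (suc m) → ℕ → Set
IsLifting f n = HasDiameter f × Bijective _≡_ _≡_ (induced f n)
  where open import Data.Product using (_×_)

window : (k : ℕ) → (ℤ → Bool) → ℤ → Vec Bool k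
window k y s = tabulate λ (a : Fin k) → y ((+ toℕ a) +ℤ s)

addVar : ∀ {k} → BoolFun k → Fin k → BoolFun k
addVar f j x = f x xor lookup x j

shiftOf : ∀ {k} → Fin k → Fin k → ℤ
shiftOf j i = (+ toℕ i) - (+ toℕ j)

{-# OPTIONS --safe #-}
-- Put g = f ⊕ x_j. On bi-infinite sequences X : ℤ → Bool, the rule f acts as the toggle
-- X ↦ (z ↦ X_z ⊕ g(X_{z-j}, …, X_{z-j+k-1})) followed by a translation by j; the window starting
-- at s reads position s + i, which the toggle flips iff g fires on the window starting at s + (i - j).
-- The orthogonality hypothesis says precisely that this never happens when g fires at s and depends
-- on x_i. So toggling changes no variable read by a firing window, and (applying this to the toggled
-- sequence) creates no new firing window: g fires on the same windows before and after, and the toggle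
-- is an involution. Both maps commute with translations, hence preserve n-periodic sequences, which
-- are the vectors of length n, and there they invert F for every n ≥ 1.
module Submission where

open import Defs
open import Data.Bool using (Bool; true; false; not; _xor_; _∧_)
open import Data.Bool.Properties
  using (_≟_; ¬-not; ⇔→≡; xor-assoc; xor-comm; xor-same; xor-identityʳ)
open import Data.Fin using (Fin; zero; suc; toℕ; fromℕ<)
open import Data.Fin.Properties using (toℕ<n; toℕ-fromℕ<; fromℕ<-cong; fromℕ<-toℕ)
open import Data.Integer using (ℤ; +_; _+_; _-_; -_; _*_; ∣_∣; _⊖_; _%ℕ_; _/ℕ_)
open import Data.Integer.DivMod using (n%ℕd<d; a≡a%ℕn+[a/ℕn]*n)
open import Data.Integer.Properties
  using (+-assoc; +-comm; +-identityˡ; +-injective; abs-*; m-n≡m⊖n; ∣m⊝n∣≤m⊔n; ∣i∣≡0⇒i≡0; i-j≡0⇒i≡j)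
open import Data.Integer.Tactic.RingSolver using (solve-∀)
open import Data.Nat using (ℕ; suc; _≤_; NonZero)
import Data.Nat as ℕ
import Data.Nat.Properties as ℕ
open import Data.Nat.DivMod using (m<n⇒m%n≡m; m%n<n)
open import Data.Product using (_×_; _,_)
open import Data.Vec using (Vec; []; _∷_; lookup; tabulate; _[_]%=_)
open import Data.Vec.Properties using (tabulate-cong; lookup∘tabulate; tabulate∘lookup)
open import Function using (_∘_; mk⇔)
open import Function.Consequences.Propositional
  using (inverseᵇ⇒bijective; strictlyInverseˡ⇒inverseˡ; strictlyInverseʳ⇒inverseʳ)
open import Relation.Nullary using (¬_; contradiction)
open import Relation.Nullary.Decidable using (decidable-stable; yes; no)
open import Relation.Binary.PropositionalEquality
  using (_≡_; _≗_; refl; sym; trans; cong; cong₂; subst₂; module ≡-Reasoning)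

open ≡-Reasoning

private
  add-sub-cancel : ∀ a b → a + b - b ≡ a
  add-sub-cancel = solve-∀

  sub-add-cancel : ∀ a b → a - b + b ≡ a
  sub-add-cancel = solve-∀

  add-sub-comm : ∀ a b c → a + b - c ≡ a - c + b
  add-sub-comm = solve-∀

  sub-as-shifted-sub : ∀ a b c → a - b ≡ (a + c) - (b + c)
  sub-as-shifted-sub = solve-∀

  sub-multiples : ∀ a b c e → (a + b * e) - (a + c * e) ≡ (b - c) * e
  sub-multiples = solve-∀

  add-multiples : ∀ a b c e → a + b * e + c * e ≡ a + (b + c) * e
  add-multiples = solve-∀

  add-comm-assoc : ∀ a b c → a + b + c ≡ a + c + b
  add-comm-assoc = solve-∀

xor-cancelʳ : ∀ x y → (x xor y) xor y ≡ x
xor-cancelʳ x y = trans (xor-assoc x y y) (trans (cong (x xor_) (xor-same y)) (xor-identityʳ x))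

¬DependsOn⇒flip-invariant : ∀ {k} (g : BoolFun k) i →
  ¬ DependsOn g i → ∀ U → g U ≡ g (U [ i ]%= not)
¬DependsOn⇒flip-invariant g i independent U =
  decidable-stable (g U ≟ g (U [ i ]%= not)) (λ g-flips → independent (U , g-flips))

support-determines : ∀ {k} (g : BoolFun k) {U V : Vec Bool k} →
  (∀ i → DependsOn g i → lookup U i ≡ lookup V i) → g U ≡ g V
support-determines g {[]} {[]} _ = refl
support-determines g {u ∷ U} {v ∷ V} agree =
  trans head-step (support-determines (g ∘ (v ∷_)) (λ i (W , flips) → agree (suc i) (v ∷ W , flips)))
  where
  head-step : g (u ∷ U) ≡ g (v ∷ U)
  head-step with u ≟ v
  ... | yes refl = refl
  ... | no u≢v = trans (¬DependsOn⇒flip-invariant g zero (u≢v ∘ agree zero) (u ∷ U))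
                       (cong (λ b → g (b ∷ U)) (sym (¬-not (u≢v ∘ sym))))

Seq : Set
Seq = ℤ → Bool

shift : ℤ → Seq → Seq
shift t X z = X (z + t)

Periodic : ℕ → Seq → Set
Periodic n X = ∀ q z → X (z + q * + n) ≡ X z

shift-cong : ∀ t {X Y} → X ≗ Y → shift t X ≗ shift t Y
shift-cong t X≗Y z = X≗Y (z + t)

shift-periodic : ∀ t {n X} → Periodic n X → Periodic n (shift t X)
shift-periodic t {n} {X} per q z = trans (cong X (add-comm-assoc z (q * + n) t)) (per q (z + t))

shift-inverseˡ : ∀ t X → shift t (shift (- t) X) ≗ X
shift-inverseˡ t X z = cong X (add-sub-cancel z t)

shift-inverseʳ : ∀ t X → shift (- t) (shift t X) ≗ X
shift-inverseʳ t X z = cong X (sub-add-cancel z t)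

module _ {k : ℕ} where

  lookup-window : ∀ X s i → lookup (window k X s) i ≡ X (+ toℕ i + s)
  lookup-window X s = lookup∘tabulate (λ a → X (+ toℕ a + s))

  window-cong : ∀ {X Y} → X ≗ Y → ∀ s → window k X s ≡ window k Y s
  window-cong X≗Y s = tabulate-cong (λ a → X≗Y (+ toℕ a + s))

  window-shift : ∀ X t s → window k (shift t X) s ≡ window k X (s + t)
  window-shift X t s = tabulate-cong (λ a → cong X (+-assoc (+ toℕ a) s t))

  window-periodic : ∀ {n X} → Periodic n X → ∀ q s → window k X (s + q * + n) ≡ window k X s
  window-periodic {n} {X} per q s =
    tabulate-cong (λ a → trans (cong X (sym (+-assoc (+ toℕ a) s (q * + n)))) (per q (+ toℕ a + s)))

ShiftOrthogonal : ∀ {k} → BoolFun k → Fin k → Set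
ShiftOrthogonal {k} g j = (i : Fin k) → DependsOn g i → (y : ℤ → Bool) →
  (g (window k y (+ 0)) ∧ g (window k y (shiftOf j i))) ≡ false

module _ {k : ℕ} (g : BoolFun k) (j : Fin k) where

  firing : Seq → ℤ → Bool
  firing X s = g (window k X s)

  toggle : Seq → Seq
  toggle X z = X z xor firing X (z - + toℕ j)

  toggle-cong : ∀ {X Y} → X ≗ Y → toggle X ≗ toggle Y
  toggle-cong X≗Y z = cong₂ _xor_ (X≗Y z) (cong g (window-cong X≗Y (z - + toℕ j)))

  toggle-periodic : ∀ {n X} → Periodic n X → Periodic n (toggle X)
  toggle-periodic {n} {X} per q z = cong₂ _xor_ (per q z) (cong g (begin
    window k X (z + q * + n - + toℕ j)   ≡⟨ cong (window k X) (add-sub-comm z (q * + n) (+ toℕ j)) ⟩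
    window k X (z - + toℕ j + q * + n)   ≡⟨ window-periodic per q (z - + toℕ j) ⟩
    window k X (z - + toℕ j)             ∎))

  lookup-window-toggle : ∀ X s i →
    lookup (window k (toggle X) s) i ≡ lookup (window k X s) i xor firing X (shiftOf j i + s)
  lookup-window-toggle X s i = begin
    lookup (window k (toggle X) s) i                       ≡⟨ lookup-window (toggle X) s i ⟩
    X (+ toℕ i + s) xor firing X (+ toℕ i + s - + toℕ j)   ≡⟨ cong₂ (λ b t → b xor firing X t)
                                                                 (sym (lookup-window X s i))
                                                                 (add-sub-comm (+ toℕ i) s (+ toℕ j)) ⟩
    lookup (window k X s) i xor firing X (shiftOf j i + s) ∎

  quiet-reads⇒toggle-preserves-firing : ∀ X s →
    (∀ i → DependsOn g i → firing X (shiftOf j i + s) ≡ false) → firing (toggle X) s ≡ firing X s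
  quiet-reads⇒toggle-preserves-firing X s quiet = support-determines g λ i dep → begin
    lookup (window k (toggle X) s) i                       ≡⟨ lookup-window-toggle X s i ⟩
    lookup (window k X s) i xor firing X (shiftOf j i + s) ≡⟨ cong (lookup (window k X s) i xor_)
                                                                   (quiet i dep) ⟩
    lookup (window k X s) i xor false                      ≡⟨ xor-identityʳ _ ⟩
    lookup (window k X s) i                                ∎

  module _ (orthogonal : ShiftOrthogonal g j) where

    fires-apart : ∀ X s i → DependsOn g i → firing X s ≡ true → firing X (shiftOf j i + s) ≡ false
    fires-apart X s i dep fires = subst₂ (λ b w → b ∧ g w ≡ false)
      (trans (cong g (trans (window-shift X s (+ 0)) (cong (window k X) (+-identityˡ s)))) fires)
      (window-shift X s (shiftOf j i))
      (orthogonal i dep (shift s X))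

    toggle-keeps-firing : ∀ X s → firing X s ≡ true → firing (toggle X) s ≡ true
    toggle-keeps-firing X s fires =
      trans (quiet-reads⇒toggle-preserves-firing X s (λ i dep → fires-apart X s i dep fires)) fires

    toggle-creates-no-firing : ∀ X s → firing (toggle X) s ≡ true → firing X s ≡ true
    toggle-creates-no-firing X s fires = trans (sym (quiet-reads⇒toggle-preserves-firing X s quiet)) fires
      where
      quiet : ∀ i → DependsOn g i → firing X (shiftOf j i + s) ≡ false
      quiet i dep = ¬-not λ fires′ → contradiction
        (trans (sym (toggle-keeps-firing X (shiftOf j i + s) fires′))
               (fires-apart (toggle X) s i dep fires))
        λ ()

    toggle-preserves-firing : ∀ X s → firing (toggle X) s ≡ firing X s
    toggle-preserves-firing X s = ⇔→≡ (mk⇔ (toggle-creates-no-firing X s) (toggle-keeps-firing X s))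

    toggle-involutive : ∀ X → toggle (toggle X) ≗ X
    toggle-involutive X z = begin
      toggle X z xor firing (toggle X) (z - J) ≡⟨ cong (toggle X z xor_)
                                                     (toggle-preserves-firing X (z - J)) ⟩
      toggle X z xor firing X (z - J)          ≡⟨ xor-cancelʳ (X z) (firing X (z - J)) ⟩
      X z                                      ∎
      where J = + toℕ j

slidingMap : ∀ {k} → BoolFun k → Seq → Seq
slidingMap {k} f X z = f (window k X z)

slidingMap-cong : ∀ {k} (f : BoolFun k) {X Y} → X ≗ Y → slidingMap f X ≗ slidingMap f Y
slidingMap-cong f X≗Y z = cong f (window-cong X≗Y z)

slidingMap-periodic : ∀ {k} (f : BoolFun k) {n X} → Periodic n X → Periodic n (slidingMap f X)
slidingMap-periodic f per q z = cong f (window-periodic per q z)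

slidingMap≗shift∘toggle : ∀ {k} (f : BoolFun k) j X →
  slidingMap f X ≗ shift (+ toℕ j) (toggle (addVar f j) j X)
slidingMap≗shift∘toggle {k} f j X z = begin
  f w                             ≡⟨ sym (xor-cancelʳ (f w) (lookup w j)) ⟩
  addVar f j w xor lookup w j     ≡⟨ xor-comm (addVar f j w) (lookup w j) ⟩
  lookup w j xor addVar f j w     ≡⟨ cong₂ (λ b t → b xor addVar f j (window k X t))
                                       (trans (lookup-window X z j) (cong X (+-comm J z)))
                                       (sym (add-sub-cancel z J)) ⟩
  X (z + J) xor addVar f j (window k X (z + J - J)) ∎
  where
  J = + toℕ j
  w = window k X z

record PeriodicInverse : Set where
  field
    to from       : Seq → Seq
    to-cong       : ∀ {X Y} → X ≗ Y → to X ≗ to Y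
    from-cong     : ∀ {X Y} → X ≗ Y → from X ≗ from Y
    to-periodic   : ∀ {n X} → Periodic n X → Periodic n (to X)
    from-periodic : ∀ {n X} → Periodic n X → Periodic n (from X)
    inverseˡ      : ∀ Y → to (from Y) ≗ Y
    inverseʳ      : ∀ X → from (to X) ≗ X

slidingMap-inverse : ∀ {k} (f : BoolFun k) j → ShiftOrthogonal (addVar f j) j → PeriodicInverse
slidingMap-inverse f j orthogonal = record
  { to            = slidingMap f
  ; from          = from
  ; to-cong       = slidingMap-cong f
  ; from-cong     = λ X≗Y → toggle-cong g j (shift-cong (- J) X≗Y)
  ; to-periodic   = slidingMap-periodic f
  ; from-periodic = λ per → toggle-periodic g j (shift-periodic (- J) per)
  ; inverseˡ      = inverseˡ
  ; inverseʳ      = inverseʳ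
  }
  where
  g = addVar f j
  J = + toℕ j

  from : Seq → Seq
  from Y = toggle g j (shift (- J) Y)

  inverseˡ : ∀ Y → slidingMap f (from Y) ≗ Y
  inverseˡ Y z = begin
    slidingMap f (from Y) z
      ≡⟨ slidingMap≗shift∘toggle f j (from Y) z ⟩
    toggle g j (toggle g j (shift (- J) Y)) (z + J)
      ≡⟨ toggle-involutive g j orthogonal (shift (- J) Y) (z + J) ⟩
    shift J (shift (- J) Y) z
      ≡⟨ shift-inverseˡ J Y z ⟩
    Y z ∎

  inverseʳ : ∀ X → from (slidingMap f X) ≗ X
  inverseʳ X z = begin
    from (slidingMap f X) z
      ≡⟨ toggle-cong g j (shift-cong (- J) (slidingMap≗shift∘toggle f j X)) z ⟩
    toggle g j (shift (- J) (shift J (toggle g j X))) z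
      ≡⟨ toggle-cong g j (shift-inverseʳ J (toggle g j X)) z ⟩
    toggle g j (toggle g j X) z
      ≡⟨ toggle-involutive g j orthogonal X z ⟩
    X z ∎

m*n<n⇒m≡0 : ∀ m n → m ℕ.* n ℕ.< n → m ≡ 0
m*n<n⇒m≡0 0       n _     = refl
m*n<n⇒m≡0 (suc m) n m*n<n = contradiction (ℕ.m≤m+n n (m ℕ.* n)) (ℕ.<⇒≱ m*n<n)

module _ {d : ℕ} .{{_ : NonZero d}} where

  remainder-unique : ∀ {r r′} q q′ → r ℕ.< d → r′ ℕ.< d →
    + r + q * + d ≡ + r′ + q′ * + d → r ≡ r′
  remainder-unique {r} {r′} q q′ r<d r′<d eq =
    +-injective (i-j≡0⇒i≡j (+ r) (+ r′) (trans difference (cong (_* + d) quotients-equal)))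
    where
    difference : + r - + r′ ≡ (q′ - q) * + d
    difference = begin
      + r - + r′                           ≡⟨ sub-as-shifted-sub (+ r) (+ r′) (q * + d) ⟩
      (+ r + q * + d) - (+ r′ + q * + d)   ≡⟨ cong (_- (+ r′ + q * + d)) eq ⟩
      (+ r′ + q′ * + d) - (+ r′ + q * + d) ≡⟨ sub-multiples (+ r′) q′ q (+ d) ⟩
      (q′ - q) * + d                       ∎

    gap<d : ∣ q′ - q ∣ ℕ.* d ℕ.< d
    gap<d = ℕ.≤-<-trans (ℕ.≤-reflexive gap≡∣r⊖r′∣)
                        (ℕ.≤-<-trans (∣m⊝n∣≤m⊔n r r′) (ℕ.⊔-lub r<d r′<d))
      where
      gap≡∣r⊖r′∣ : ∣ q′ - q ∣ ℕ.* d ≡ ∣ r ⊖ r′ ∣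
      gap≡∣r⊖r′∣ = trans (sym (abs-* (q′ - q) (+ d)))
                         (cong ∣_∣ (trans (sym difference) (m-n≡m⊖n r r′)))

    quotients-equal : q′ - q ≡ + 0
    quotients-equal = ∣i∣≡0⇒i≡0 (m*n<n⇒m≡0 ∣ q′ - q ∣ d gap<d)

  %ℕ-periodic : ∀ z q → (z + q * + d) %ℕ d ≡ z %ℕ d
  %ℕ-periodic z q =
    remainder-unique (w /ℕ d) (z /ℕ d + q) (n%ℕd<d w d) (n%ℕd<d z d) (begin
      + (w %ℕ d) + (w /ℕ d) * + d           ≡⟨ sym (a≡a%ℕn+[a/ℕn]*n w d) ⟩
      z + q * + d                           ≡⟨ cong (_+ q * + d) (a≡a%ℕn+[a/ℕn]*n z d) ⟩
      + (z %ℕ d) + (z /ℕ d) * + d + q * + d ≡⟨ add-multiples (+ (z %ℕ d)) (z /ℕ d) q (+ d) ⟩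
      + (z %ℕ d) + (z /ℕ d + q) * + d       ∎)
    where w = z + q * + d

module Cyclic (n : ℕ) .{{_ : NonZero n}} where

  residue : ℤ → Fin n
  residue z = fromℕ< (n%ℕd<d z n)

  cyclic : Vec Bool n → Seq
  cyclic x z = lookup x (residue z)

  restrict : Seq → Vec Bool n
  restrict X = tabulate (λ i → X (+ toℕ i))

  conjugate : (Seq → Seq) → Vec Bool n → Vec Bool n
  conjugate T x = restrict (T (cyclic x))

  cyclic-periodic : ∀ x → Periodic n (cyclic x)
  cyclic-periodic x q z = cong (lookup x) (fromℕ<-cong _ _ (%ℕ-periodic z q) _ _)

  restrict-cyclic : ∀ x → restrict (cyclic x) ≡ x
  restrict-cyclic x = trans (tabulate-cong residue-toℕ) (tabulate∘lookup x)
    where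
    residue-toℕ : ∀ i → lookup x (residue (+ toℕ i)) ≡ lookup x i
    residue-toℕ i = cong (lookup x)
      (trans (fromℕ<-cong _ _ (m<n⇒m%n≡m (toℕ<n i)) _ (toℕ<n i)) (fromℕ<-toℕ i _))

  cyclic-restrict : ∀ {X} → Periodic n X → cyclic (restrict X) ≗ X
  cyclic-restrict {X} per z = begin
    lookup (restrict X) (residue z)              ≡⟨ lookup∘tabulate _ (residue z) ⟩
    X (+ toℕ (residue z))                        ≡⟨ cong (X ∘ +_) (toℕ-fromℕ< (n%ℕd<d z n)) ⟩
    X (+ (z %ℕ n))                               ≡⟨ sym (per (z /ℕ n) (+ (z %ℕ n))) ⟩
    X (+ (z %ℕ n) + (z /ℕ n) * + n)              ≡⟨ cong X (sym (a≡a%ℕn+[a/ℕn]*n z n)) ⟩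
    X z                                          ∎

  restrict-cong : ∀ {X Y} → X ≗ Y → restrict X ≡ restrict Y
  restrict-cong X≗Y = tabulate-cong (λ i → X≗Y (+ toℕ i))

  conjugate-inverse : ∀ {T S} → (∀ {X Y} → X ≗ Y → T X ≗ T Y) →
    (∀ {X} → Periodic n X → Periodic n (S X)) → (∀ X → T (S X) ≗ X) →
    ∀ x → conjugate T (conjugate S x) ≡ x
  conjugate-inverse {T} {S} T-cong S-periodic T∘S x = begin
    restrict (T (cyclic (restrict (S (cyclic x)))))
      ≡⟨ restrict-cong (T-cong (cyclic-restrict (S-periodic (cyclic-periodic x)))) ⟩
    restrict (T (S (cyclic x)))
      ≡⟨ restrict-cong (T∘S (cyclic x)) ⟩
    restrict (cyclic x)
      ≡⟨ restrict-cyclic x ⟩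
    x ∎

induced≡conjugate : ∀ {k} (f : BoolFun k) n x →
  induced f (suc n) x ≡ Cyclic.conjugate (suc n) (slidingMap f) x
induced≡conjugate f n x = tabulate-cong λ i → cong f (tabulate-cong λ a →
  cong (lookup x) (fromℕ<-cong _ _ (cong (ℕ._% suc n) (ℕ.+-comm (toℕ i) (toℕ a)))
                                   (m%n<n (toℕ i ℕ.+ toℕ a) (suc n))
                                   (m%n<n (toℕ a ℕ.+ toℕ i) (suc n))))

mainTheorem2 : (m : ℕ) (f : BoolFun (suc m)) →
    HasDiameter f →
    (j : Fin (suc m)) →
    ¬ DependsOn (addVar f j) j →
    ((i : Fin (suc m)) → DependsOn (addVar f j) i →
      (y : ℤ → Bool) →
      (addVar f j (window (suc m) y (+ 0)) ∧ addVar f j (window (suc m) y (shiftOf j i))) ≡ false) →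
    (n : ℕ) → suc m ≤ n → IsLifting f n
mainTheorem2 m f _        j _ _          0       ()
mainTheorem2 m f diameter j _ orthogonal (suc n) _ =
  diameter , inverseᵇ⇒bijective ( strictlyInverseˡ⇒inverseˡ {f⁻¹ = G} F F∘G
                                , strictlyInverseʳ⇒inverseʳ {f⁻¹ = G} F G∘F)
  where
  open Cyclic (suc n)
  open PeriodicInverse (slidingMap-inverse f j orthogonal)

  F G : Vec Bool (suc n) → Vec Bool (suc n)
  F = induced f (suc n)
  G = conjugate from

  F∘G : ∀ y → F (G y) ≡ y
  F∘G y = trans (induced≡conjugate f n (G y)) (conjugate-inverse to-cong from-periodic inverseˡ y)

  G∘F : ∀ x → G (F x) ≡ x
  G∘F x = trans (cong G (induced≡conjugate f n x)) (conjugate-inverse from-cong to-periodic inverseʳ x)
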